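{- For every $n$, no $10$-cap in $\mathbb{Z}_2^n$ is complete.
   Context: Work in $\mathbb{Z}_2^n$. The affine span $\operatorname{aff}(S)$ of a subset $S$ is the set of all sums of an odd number of distinct elements of $S$. A quad is a set of four distinct elements summing to $\mathbf{0}$; a cap is a quad-free subset; a $k$-cap is a cap with $k$ elements. A cap $C$ is complete if it is a maximal quad-free subset of $\operatorname{aff}(C)$, equivalently if $C\cup\{x+y+z : x,y,z\in C \text{ distinct}\}=\operatorname{aff}(C)$. -}

module Defs where

open import Data.Bool using (Bool; true; false; _xor_)
open import Data.Nat using (ℕ; _%_)
open import Data.Fin using (Fin)
open import Data.Fin.Subset using (Subset; ∣_∣)
open import Data.Vec using (Vec; []; _∷_; zipWith; replicate)
open import Data.Product using (Σ; ∃; _×_; _,_)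
open import Data.Sum using (_⊎_)
open import Relation.Binary.PropositionalEquality using (_≡_; _≢_)
open import Function.Definitions using (Injective)

V : ℕ → Set
V n = Vec Bool n

infixl 6 _⊕_
_⊕_ : ∀ {n} → V n → V n → V n
_⊕_ = zipWith _xor_

𝟎 : ∀ {n} → V n
𝟎 {n} = replicate n false

-- A finite k-element subset of Z_2^n is given as an injective enumeration
-- c : Fin k → V n ; membership in it:
_∈ₛ_ : ∀ {n k} → V n → (Fin k → V n) → Set
v ∈ₛ c = ∃ λ i → c i ≡ v

sumOver : ∀ {n k} → (Fin k → V n) → Subset k → V n
sumOver {k = ℕ.zero} c [] = 𝟎
sumOver {k = ℕ.suc k} c (true ∷ T) = c Fin.zero ⊕ sumOver (λ i → c (Fin.suc i)) T
sumOver {k = ℕ.suc k} c (false ∷ T) = sumOver (λ i → c (Fin.suc i)) T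

_∈aff_ : ∀ {n k} → V n → (Fin k → V n) → Set
v ∈aff c = ∃ λ T → (∣ T ∣ % 2 ≡ 1) × (sumOver c T ≡ v)

IsCap : ∀ {n k} → (Fin k → V n) → Set
IsCap c = ∀ a b d e → a ∈ₛ c → b ∈ₛ c → d ∈ₛ c → e ∈ₛ c →
  a ≢ b → a ≢ d → a ≢ e → b ≢ d → b ≢ e → d ≢ e →
  a ⊕ b ⊕ d ⊕ e ≢ 𝟎

_∈C+3C_ : ∀ {n k} → V n → (Fin k → V n) → Set
v ∈C+3C c = v ∈ₛ c ⊎
  (∃ λ x → ∃ λ y → ∃ λ z → x ∈ₛ c × y ∈ₛ c × z ∈ₛ c ×
     x ≢ y × x ≢ z × y ≢ z × v ≡ x ⊕ y ⊕ z)

IsComplete : ∀ {n k} → (Fin k → V n) → Set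
IsComplete c = (∀ v → v ∈aff c → v ∈C+3C c) × (∀ v → v ∈C+3C c → v ∈aff c)

-- Index the cap by Fin 10 and call T ⊆ Fin 10 a relation when the points indexed by T sum to 0;
-- relations form a binary linear code. Injectivity and the cap property forbid relations of size 2
-- and 4, so nonzero even relations have size at least 6, while completeness puts every odd T at
-- distance 1 or 3 from some (even) relation. Applied to the two halves of Fin 10 this yields
-- relations A and B; a finite check shows that, unless A, B or A ⊕ B already has a forbidden size,
-- some odd set is at distance neither 1 nor 3 from the plane {0, A, B, A ⊕ B}. Completeness then
-- gives a relation C outside that plane, so the seven nonzero combinations of A, B, C are even
-- relations of size at least 6, of total size at least 42; but in each of the 10 coordinates at
-- most 4 of them are nonzero, so the total is at most 40.

module Submission where

open import Defs
open import Algebra.Bundles using (AbelianGroup)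
open import Algebra.Structures using (IsAbelianGroup)
import Algebra.Properties.CommutativeSemigroup as CommutativeSemigroupProperties
import Algebra.Properties.Group as GroupProperties
open import Data.Bool using (Bool; true; false; _xor_)
open import Data.Bool.Properties using (xor-assoc; xor-comm; xor-identityˡ; xor-identityʳ; xor-same)
open import Data.Fin using (Fin; zero; suc)
import Data.Fin.Properties as Fin
open import Data.Fin.Subset using (Subset; ⁅_⁆; ∣_∣)
open import Data.Fin.Subset.Properties using (∣⁅x⁆∣≡1; anySubset?)
open import Data.List using (List; []; _∷_; map; foldr; length)
open import Data.List.Properties using (length-map; map-∘)
open import Data.List.Relation.Unary.All using ([]; _∷_; universal)
import Data.List.Relation.Unary.All.Properties as All
open import Data.List.Relation.Unary.AllPairs using ([]; _∷_)
open import Data.List.Relation.Unary.Any using (Any; any?; satisfied)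
open import Data.List.Relation.Unary.Unique.Propositional using (Unique)
import Data.List.Relation.Unary.Unique.Propositional.Properties as Unique
open import Data.Nat using (ℕ; zero; suc; _+_; _*_; _%_; _≤_; _≤?_; _≟_; z≤n)
open import Data.Nat.Base using (parity)
open import Data.Nat.Properties using (≤-refl; ≤-trans; +-mono-≤; *-monoˡ-≤; m≤m+n; module ≤-Reasoning)
open import Data.Nat.Tactic.RingSolver using (solve-∀)
open import Data.Parity.Base using (Parity; 0ℙ; 1ℙ) renaming (_+_ to _ℙ+_)
import Data.Parity.Properties as ℙ
open import Data.Product using (∃; _×_; _,_)
open import Data.Sum using (_⊎_; inj₁; inj₂)
import Data.Sum as Sum
open import Data.Vec using ([]; _∷_; _++_)
open import Data.Vec.Properties using (zipWith-assoc; zipWith-comm; zipWith-identityˡ; zipWith-identityʳ)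
open import Function using (id; _∘_)
open import Function.Definitions using (Injective)
open import Level using (0ℓ)
open import Relation.Binary.PropositionalEquality
  using (_≡_; _≢_; refl; sym; trans; cong; cong₂; subst; module ≡-Reasoning)
open import Relation.Binary.PropositionalEquality.Algebra using (isMagma)
open import Relation.Nullary using (¬_; ¬?; contradiction)
open import Relation.Nullary.Decidable using (Dec; _×-dec_; _⊎-dec_; from-no; decidable-stable)

⊕-self : ∀ {n} (x : V n) → x ⊕ x ≡ 𝟎
⊕-self []      = refl
⊕-self (a ∷ x) = cong₂ _∷_ (xor-same a) (⊕-self x)

⊕-isAbelianGroup : ∀ {n} → IsAbelianGroup _≡_ (_⊕_ {n}) 𝟎 id
⊕-isAbelianGroup = record
  { isGroup = record
    { isMonoid = record
      { isSemigroup = record { isMagma = isMagma _⊕_ ; assoc = zipWith-assoc xor-assoc }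
      ; identity    = zipWith-identityˡ xor-identityˡ , zipWith-identityʳ xor-identityʳ
      }
    ; inverse = ⊕-self , ⊕-self
    ; ⁻¹-cong = cong id
    }
  ; comm = zipWith-comm xor-comm
  }

⊕-abelianGroup : ℕ → AbelianGroup 0ℓ 0ℓ
⊕-abelianGroup n = record { isAbelianGroup = ⊕-isAbelianGroup {n} }

module _ {n : ℕ} where
  open AbelianGroup (⊕-abelianGroup n) public
    using () renaming (assoc to ⊕-assoc; identityˡ to ⊕-identityˡ; identityʳ to ⊕-identityʳ)
  open GroupProperties (AbelianGroup.group (⊕-abelianGroup n)) public
    using () renaming (x∙y⁻¹≈ε⇒x≈y to ⊕≡𝟎⇒≡; \\-leftDividesʳ to ⊕-cancelˡ)
  open CommutativeSemigroupProperties (AbelianGroup.commutativeSemigroup (⊕-abelianGroup n)) public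
    using () renaming (interchange to ⊕-interchange; x∙yz≈y∙xz to ⊕-leftComm)

sumOver-𝟎 : ∀ {n k} (c : Fin k → V n) → sumOver c 𝟎 ≡ 𝟎
sumOver-𝟎 {k = zero}  c = refl
sumOver-𝟎 {k = suc k} c = sumOver-𝟎 (c ∘ suc)

sumOver-⁅⁆ : ∀ {n k} (c : Fin k → V n) (i : Fin k) → sumOver c ⁅ i ⁆ ≡ c i
sumOver-⁅⁆ c zero    = trans (cong (c zero ⊕_) (sumOver-𝟎 (c ∘ suc))) (⊕-identityʳ (c zero))
sumOver-⁅⁆ c (suc i) = sumOver-⁅⁆ (c ∘ suc) i

sumOver-⊕ : ∀ {n k} (c : Fin k → V n) (p q : Subset k) → sumOver c (p ⊕ q) ≡ sumOver c p ⊕ sumOver c q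
sumOver-⊕ c []          []          = sym (⊕-identityʳ 𝟎)
sumOver-⊕ c (false ∷ p) (false ∷ q) = sumOver-⊕ (c ∘ suc) p q
sumOver-⊕ c (true ∷ p)  (false ∷ q) =
  trans (cong (c zero ⊕_) (sumOver-⊕ (c ∘ suc) p q)) (sym (⊕-assoc (c zero) _ _))
sumOver-⊕ c (false ∷ p) (true ∷ q)  =
  trans (cong (c zero ⊕_) (sumOver-⊕ (c ∘ suc) p q)) (⊕-leftComm (c zero) _ _)
sumOver-⊕ c (true ∷ p)  (true ∷ q)  = begin
  sumOver c′ (p ⊕ q)          ≡⟨ sumOver-⊕ c′ p q ⟩
  s ⊕ t                       ≡⟨ ⊕-identityˡ (s ⊕ t) ⟨
  𝟎 ⊕ (s ⊕ t)                 ≡⟨ cong (_⊕ (s ⊕ t)) (⊕-self (c zero)) ⟨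
  (c zero ⊕ c zero) ⊕ (s ⊕ t) ≡⟨ ⊕-interchange (c zero) (c zero) s t ⟩
  (c zero ⊕ s) ⊕ (c zero ⊕ t) ∎
  where
  open ≡-Reasoning
  c′ = c ∘ suc
  s = sumOver c′ p
  t = sumOver c′ q

Relation : ∀ {n k} → (Fin k → V n) → Subset k → Set
Relation c p = sumOver c p ≡ 𝟎

relation-⊕ : ∀ {n k} {c : Fin k → V n} (p q : Subset k) → Relation c p → Relation c q → Relation c (p ⊕ q)
relation-⊕ {c = c} p q rel-p rel-q =
  trans (sumOver-⊕ c p q) (trans (cong₂ _⊕_ rel-p rel-q) (⊕-identityʳ 𝟎))

elements : ∀ {k} → Subset k → List (Fin k)
elements []          = []
elements (true ∷ p)  = zero ∷ map suc (elements p)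
elements (false ∷ p) = map suc (elements p)

length-elements : ∀ {k} (p : Subset k) → length (elements p) ≡ ∣ p ∣
length-elements []          = refl
length-elements (true ∷ p)  = cong suc (trans (length-map suc (elements p)) (length-elements p))
length-elements (false ∷ p) = trans (length-map suc (elements p)) (length-elements p)

elements-unique : ∀ {k} (p : Subset k) → Unique (elements p)
elements-unique []          = []
elements-unique (true ∷ p)  =
  All.map⁺ (universal (λ _ ()) (elements p)) ∷ Unique.map⁺ Fin.suc-injective (elements-unique p)
elements-unique (false ∷ p) = Unique.map⁺ Fin.suc-injective (elements-unique p)

sumᵥ : ∀ {n} → List (V n) → V n
sumᵥ = foldr _⊕_ 𝟎

sumOver-elements : ∀ {n k} (c : Fin k → V n) (p : Subset k) → sumOver c p ≡ sumᵥ (map c (elements p))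
sumOver-elements c []          = refl
sumOver-elements c (true ∷ p)  =
  cong (c zero ⊕_) (trans (sumOver-elements (c ∘ suc) p) (cong sumᵥ (map-∘ (elements p))))
sumOver-elements c (false ∷ p) =
  trans (sumOver-elements (c ∘ suc) p) (cong sumᵥ (map-∘ (elements p)))

∣p∣≡0⇒p≡𝟎 : ∀ {k} (p : Subset k) → ∣ p ∣ ≡ 0 → p ≡ 𝟎
∣p∣≡0⇒p≡𝟎 []          _    = refl
∣p∣≡0⇒p≡𝟎 (true ∷ p)  ()
∣p∣≡0⇒p≡𝟎 (false ∷ p) ∣p∣≡0 = cong (false ∷_) (∣p∣≡0⇒p≡𝟎 p ∣p∣≡0)

TwoOrFour : ℕ → Set
TwoOrFour w = w ≡ 2 ⊎ w ≡ 4

module _ {n k} {c : Fin k → V n} (c-injective : Injective _≡_ _≡_ c) (cap : IsCap c) where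

  no-relation-of-size-two-or-four : ∀ p → Relation c p → ¬ TwoOrFour ∣ p ∣
  no-relation-of-size-two-or-four p rel size =
    no-short-relation (elements p) (elements-unique p)
      (Sum.map (trans (length-elements p)) (trans (length-elements p)) size)
      (trans (sym (sumOver-elements c p)) rel)
    where
    no-short-relation : ∀ is → Unique is → TwoOrFour (length is) → sumᵥ (map c is) ≢ 𝟎
    no-short-relation (a ∷ b ∷ []) ((a≢b ∷ []) ∷ [] ∷ []) (inj₁ refl) sum≡𝟎 =
      a≢b (c-injective (⊕≡𝟎⇒≡ (c a) (c b) (trans (cong (c a ⊕_) (sym (⊕-identityʳ (c b)))) sum≡𝟎)))
    no-short-relation (a ∷ b ∷ d ∷ e ∷ [])
      ((a≢b ∷ a≢d ∷ a≢e ∷ []) ∷ (b≢d ∷ b≢e ∷ []) ∷ (d≢e ∷ []) ∷ [] ∷ []) (inj₂ refl) sum≡𝟎 =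
      cap (c a) (c b) (c d) (c e) (a , refl) (b , refl) (d , refl) (e , refl)
        (distinct a≢b) (distinct a≢d) (distinct a≢e) (distinct b≢d) (distinct b≢e) (distinct d≢e)
        (trans reassociate sum≡𝟎)
      where
      distinct : ∀ {i j} → i ≢ j → c i ≢ c j
      distinct i≢j = i≢j ∘ c-injective
      reassociate : c a ⊕ c b ⊕ c d ⊕ c e ≡ c a ⊕ (c b ⊕ (c d ⊕ (c e ⊕ 𝟎)))
      reassociate = begin
        c a ⊕ c b ⊕ c d ⊕ c e         ≡⟨ ⊕-assoc (c a ⊕ c b) (c d) (c e) ⟩
        c a ⊕ c b ⊕ (c d ⊕ c e)       ≡⟨ ⊕-assoc (c a) (c b) (c d ⊕ c e) ⟩
        c a ⊕ (c b ⊕ (c d ⊕ c e))     ≡⟨ cong (λ x → c a ⊕ (c b ⊕ (c d ⊕ x))) (⊕-identityʳ (c e)) ⟨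
        c a ⊕ (c b ⊕ (c d ⊕ (c e ⊕ 𝟎))) ∎
        where open ≡-Reasoning

  even-relation-size≥6 : ∀ p → parity ∣ p ∣ ≡ 0ℙ → p ≢ 𝟎 → Relation c p → 6 ≤ ∣ p ∣
  even-relation-size≥6 p even p≢𝟎 rel with ∣ p ∣ in size
  ... | 0 = contradiction (∣p∣≡0⇒p≡𝟎 p size) p≢𝟎
  ... | 2 = contradiction (inj₁ size) (no-relation-of-size-two-or-four p rel)
  ... | 4 = contradiction (inj₂ size) (no-relation-of-size-two-or-four p rel)
  ... | suc (suc (suc (suc (suc (suc w))))) = m≤m+n 6 w
  even-relation-size≥6 p () _ _ | 1
  even-relation-size≥6 p () _ _ | 3
  even-relation-size≥6 p () _ _ | 5

bitParity : Bool → Parity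
bitParity false = 0ℙ
bitParity true  = 1ℙ

parity-∣∷∣ : ∀ {k} x (p : Subset k) → parity ∣ x ∷ p ∣ ≡ bitParity x ℙ+ parity ∣ p ∣
parity-∣∷∣ false p = refl
parity-∣∷∣ true  p = ℙ.+-homo-+ 1 ∣ p ∣

bitParity-xor : ∀ x y → bitParity (x xor y) ≡ bitParity x ℙ+ bitParity y
bitParity-xor false y     = refl
bitParity-xor true  false = refl
bitParity-xor true  true  = refl

parity-∣⊕∣ : ∀ {k} (p q : Subset k) → parity ∣ p ⊕ q ∣ ≡ parity ∣ p ∣ ℙ+ parity ∣ q ∣
parity-∣⊕∣ []      []      = refl
parity-∣⊕∣ (x ∷ p) (y ∷ q) = begin
  parity ∣ (x xor y) ∷ (p ⊕ q) ∣                        ≡⟨ parity-∣∷∣ (x xor y) (p ⊕ q) ⟩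
  bitParity (x xor y) ℙ+ parity ∣ p ⊕ q ∣              ≡⟨ cong₂ _ℙ+_ (bitParity-xor x y) (parity-∣⊕∣ p q) ⟩
  (bitParity x ℙ+ bitParity y) ℙ+ (parity ∣ p ∣ ℙ+ parity ∣ q ∣)
    ≡⟨ ℙ+-interchange (bitParity x) (bitParity y) (parity ∣ p ∣) (parity ∣ q ∣) ⟩
  (bitParity x ℙ+ parity ∣ p ∣) ℙ+ (bitParity y ℙ+ parity ∣ q ∣)
    ≡⟨ cong₂ _ℙ+_ (parity-∣∷∣ x p) (parity-∣∷∣ y q) ⟨
  parity ∣ x ∷ p ∣ ℙ+ parity ∣ y ∷ q ∣                 ∎
  where
  open ≡-Reasoning
  open CommutativeSemigroupProperties ℙ.+-commutativeSemigroup using () renaming (interchange to ℙ+-interchange)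

parity≡1ℙ⇒%2≡1 : ∀ w → parity w ≡ 1ℙ → w % 2 ≡ 1
parity≡1ℙ⇒%2≡1 1             _   = refl
parity≡1ℙ⇒%2≡1 (suc (suc w)) odd = parity≡1ℙ⇒%2≡1 w odd

OneOrThree : ℕ → Set
OneOrThree w = w ≡ 1 ⊎ w ≡ 3

oneOrThree⇒odd : ∀ {w} → OneOrThree w → parity w ≡ 1ℙ
oneOrThree⇒odd (inj₁ refl) = refl
oneOrThree⇒odd (inj₂ refl) = refl

Near : ∀ {k} → Subset k → Subset k → Set
Near S R = OneOrThree ∣ S ⊕ R ∣

near-odd⇒even : ∀ {k} (S R : Subset k) → parity ∣ S ∣ ≡ 1ℙ → Near S R → parity ∣ R ∣ ≡ 0ℙ
near-odd⇒even S R odd near = begin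
  parity ∣ R ∣                      ≡⟨ cong (parity ∘ ∣_∣) (⊕-cancelˡ S R) ⟨
  parity ∣ S ⊕ (S ⊕ R) ∣            ≡⟨ parity-∣⊕∣ S (S ⊕ R) ⟩
  parity ∣ S ∣ ℙ+ parity ∣ S ⊕ R ∣  ≡⟨ cong₂ _ℙ+_ odd (oneOrThree⇒odd near) ⟩
  1ℙ ℙ+ 1ℙ                          ∎
  where open ≡-Reasoning

∣p⊕⁅i⁆∣≡∣p∣±1 : ∀ {k} (p : Subset k) i → ∣ p ⊕ ⁅ i ⁆ ∣ ≡ suc ∣ p ∣ ⊎ suc ∣ p ⊕ ⁅ i ⁆ ∣ ≡ ∣ p ∣
∣p⊕⁅i⁆∣≡∣p∣±1 (true ∷ p)  zero    = inj₂ (cong (suc ∘ ∣_∣) (⊕-identityʳ p))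
∣p⊕⁅i⁆∣≡∣p∣±1 (false ∷ p) zero    = inj₁ (cong (suc ∘ ∣_∣) (⊕-identityʳ p))
∣p⊕⁅i⁆∣≡∣p∣±1 (true ∷ p)  (suc i) = Sum.map (cong suc) (cong suc) (∣p⊕⁅i⁆∣≡∣p∣±1 p i)
∣p⊕⁅i⁆∣≡∣p∣±1 (false ∷ p) (suc i) = ∣p⊕⁅i⁆∣≡∣p∣±1 p i

-- The three points need not be distinct: two steps of ±1 from 1 end in 1 or 3.
oneOrThree-∣⁅a⁆⊕⁅b⁆⊕⁅d⁆∣ : ∀ {k} (a b d : Fin k) → OneOrThree ∣ ⁅ a ⁆ ⊕ ⁅ b ⁆ ⊕ ⁅ d ⁆ ∣
oneOrThree-∣⁅a⁆⊕⁅b⁆⊕⁅d⁆∣ a b d =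
  two-steps (∣⁅x⁆∣≡1 a) (∣p⊕⁅i⁆∣≡∣p∣±1 ⁅ a ⁆ b) (∣p⊕⁅i⁆∣≡∣p∣±1 (⁅ a ⁆ ⊕ ⁅ b ⁆) d)
  where
  two-steps : ∀ {w₀ w₁ w₂} → w₀ ≡ 1 → w₁ ≡ suc w₀ ⊎ suc w₁ ≡ w₀ → w₂ ≡ suc w₁ ⊎ suc w₂ ≡ w₁ → OneOrThree w₂
  two-steps refl (inj₁ refl) (inj₁ refl) = inj₂ refl
  two-steps refl (inj₁ refl) (inj₂ refl) = inj₁ refl
  two-steps refl (inj₂ refl) (inj₁ refl) = inj₁ refl
  two-steps refl (inj₂ refl) (inj₂ ())

module _ {n k} {c : Fin k → V n} where

  C+3C⇒sum-of-one-or-three : ∀ {v} → v ∈C+3C c → ∃ λ U → OneOrThree ∣ U ∣ × sumOver c U ≡ v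
  C+3C⇒sum-of-one-or-three (inj₁ (i , cᵢ≡v)) = ⁅ i ⁆ , inj₁ (∣⁅x⁆∣≡1 i) , trans (sumOver-⁅⁆ c i) cᵢ≡v
  C+3C⇒sum-of-one-or-three (inj₂ (_ , _ , _ , (a , refl) , (b , refl) , (d , refl) , _ , _ , _ , v≡sum)) =
    ⁅ a ⁆ ⊕ ⁅ b ⁆ ⊕ ⁅ d ⁆ , oneOrThree-∣⁅a⁆⊕⁅b⁆⊕⁅d⁆∣ a b d , trans sum-abd (sym v≡sum)
    where
    sum-abd : sumOver c (⁅ a ⁆ ⊕ ⁅ b ⁆ ⊕ ⁅ d ⁆) ≡ c a ⊕ c b ⊕ c d
    sum-abd = begin
      sumOver c (⁅ a ⁆ ⊕ ⁅ b ⁆ ⊕ ⁅ d ⁆)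
        ≡⟨ sumOver-⊕ c (⁅ a ⁆ ⊕ ⁅ b ⁆) ⁅ d ⁆ ⟩
      sumOver c (⁅ a ⁆ ⊕ ⁅ b ⁆) ⊕ sumOver c ⁅ d ⁆
        ≡⟨ cong (_⊕ sumOver c ⁅ d ⁆) (sumOver-⊕ c ⁅ a ⁆ ⁅ b ⁆) ⟩
      sumOver c ⁅ a ⁆ ⊕ sumOver c ⁅ b ⁆ ⊕ sumOver c ⁅ d ⁆
        ≡⟨ cong₂ _⊕_ (cong₂ _⊕_ (sumOver-⁅⁆ c a) (sumOver-⁅⁆ c b)) (sumOver-⁅⁆ c d) ⟩
      c a ⊕ c b ⊕ c d
        ∎
      where open ≡-Reasoning

  complete⇒odd-near-relation : IsComplete c → ∀ S → ∣ S ∣ % 2 ≡ 1 → ∃ λ R → Relation c R × Near S R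
  complete⇒odd-near-relation (aff⊆C+3C , _) S odd
    with C+3C⇒sum-of-one-or-three (aff⊆C+3C (sumOver c S) (S , odd , refl))
  ... | U , size , ΣU≡ΣS = S ⊕ U , relation , subst OneOrThree (cong ∣_∣ (sym (⊕-cancelˡ S U))) size
    where
    relation : Relation c (S ⊕ U)
    relation = trans (sumOver-⊕ c S U) (trans (cong (sumOver c S ⊕_) ΣU≡ΣS) (⊕-self (sumOver c S)))

bit : Bool → ℕ
bit false = 0
bit true  = 1

totalWeight : ∀ {k} → Subset k → Subset k → Subset k → ℕ
totalWeight A B C = ∣ A ∣ + ∣ B ∣ + ∣ C ∣ + ∣ A ⊕ B ∣ + ∣ A ⊕ C ∣ + ∣ B ⊕ C ∣ + ∣ A ⊕ B ⊕ C ∣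

bitWeight : Bool → Bool → Bool → ℕ
bitWeight x y z = bit x + bit y + bit z + bit (x xor y) + bit (x xor z) + bit (y xor z) + bit ((x xor y) xor z)

bitWeight≤4 : ∀ x y z → bitWeight x y z ≤ 4
bitWeight≤4 false false false = z≤n
bitWeight≤4 false false true  = ≤-refl
bitWeight≤4 false true  false = ≤-refl
bitWeight≤4 false true  true  = ≤-refl
bitWeight≤4 true  false false = ≤-refl
bitWeight≤4 true  false true  = ≤-refl
bitWeight≤4 true  true  false = ≤-refl
bitWeight≤4 true  true  true  = ≤-refl

∣∷∣ : ∀ {k} x (p : Subset k) → ∣ x ∷ p ∣ ≡ bit x + ∣ p ∣
∣∷∣ false p = refl
∣∷∣ true  p = refl

totalWeight-∷ : ∀ {k} x y z (A B C : Subset k) →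
  totalWeight (x ∷ A) (y ∷ B) (z ∷ C) ≡ bitWeight x y z + totalWeight A B C
totalWeight-∷ x y z A B C = trans coordinatewise
  (regroup (bit x) (bit y) (bit z) (bit (x xor y)) (bit (x xor z)) (bit (y xor z)) (bit ((x xor y) xor z))
           (∣ A ∣) (∣ B ∣) (∣ C ∣) (∣ A ⊕ B ∣) (∣ A ⊕ C ∣) (∣ B ⊕ C ∣) (∣ A ⊕ B ⊕ C ∣))
  where
  regroup : ∀ x₁ x₂ x₃ x₄ x₅ x₆ x₇ y₁ y₂ y₃ y₄ y₅ y₆ y₇ →
    (x₁ + y₁) + (x₂ + y₂) + (x₃ + y₃) + (x₄ + y₄) + (x₅ + y₅) + (x₆ + y₆) + (x₇ + y₇)
      ≡ (x₁ + x₂ + x₃ + x₄ + x₅ + x₆ + x₇) + (y₁ + y₂ + y₃ + y₄ + y₅ + y₆ + y₇)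
  regroup = solve-∀
  coordinatewise : totalWeight (x ∷ A) (y ∷ B) (z ∷ C) ≡
    (bit x + ∣ A ∣) + (bit y + ∣ B ∣) + (bit z + ∣ C ∣) + (bit (x xor y) + ∣ A ⊕ B ∣)
      + (bit (x xor z) + ∣ A ⊕ C ∣) + (bit (y xor z) + ∣ B ⊕ C ∣) + (bit ((x xor y) xor z) + ∣ A ⊕ B ⊕ C ∣)
  coordinatewise =
    cong₂ _+_ (cong₂ _+_ (cong₂ _+_ (cong₂ _+_ (cong₂ _+_ (cong₂ _+_
      (∣∷∣ x A) (∣∷∣ y B)) (∣∷∣ z C)) (∣∷∣ (x xor y) (A ⊕ B))) (∣∷∣ (x xor z) (A ⊕ C)))
      (∣∷∣ (y xor z) (B ⊕ C))) (∣∷∣ ((x xor y) xor z) (A ⊕ B ⊕ C))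

-- Plotkin's counting argument for a three-dimensional code.
totalWeight≤4k : ∀ {k} (A B C : Subset k) → totalWeight A B C ≤ k * 4
totalWeight≤4k []      []      []      = z≤n
totalWeight≤4k {suc k} (x ∷ A) (y ∷ B) (z ∷ C) = begin
  totalWeight (x ∷ A) (y ∷ B) (z ∷ C) ≡⟨ totalWeight-∷ x y z A B C ⟩
  bitWeight x y z + totalWeight A B C ≤⟨ +-mono-≤ (bitWeight≤4 x y z) (totalWeight≤4k A B C) ⟩
  4 + k * 4                           ∎
  where open ≤-Reasoning

UncoveredBy : ∀ {k} → Subset k → Subset k → Subset k → Set
UncoveredBy A B S = parity ∣ S ∣ ≡ 1ℙ × ¬ Near S 𝟎 × ¬ Near S A × ¬ Near S B × ¬ Near S (A ⊕ B)

module _ {n k} {c : Fin k → V n} (c-injective : Injective _≡_ _≡_ c) (cap : IsCap c) (complete : IsComplete c) where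

  plane-covers-odd-subsets : k ≤ 10 → ∀ A B S → Relation c A → Relation c B →
    parity ∣ A ∣ ≡ 0ℙ → parity ∣ B ∣ ≡ 0ℙ → 6 ≤ ∣ A ∣ → 6 ≤ ∣ B ∣ → 6 ≤ ∣ A ⊕ B ∣ → ¬ UncoveredBy A B S
  plane-covers-odd-subsets k≤10 A B S rel-A rel-B even-A even-B 6≤∣A∣ 6≤∣B∣ 6≤∣A⊕B∣
                           (odd , far-𝟎 , far-A , far-B , far-A⊕B)
    with complete⇒odd-near-relation complete S (parity≡1ℙ⇒%2≡1 ∣ S ∣ odd)
  ... | C , rel-C , near-C =
    contradiction (≤-trans 42≤totalWeight (≤-trans (totalWeight≤4k A B C) (*-monoˡ-≤ 4 k≤10)))
                  (from-no (42 ≤? 40))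
    where
    even-C : parity ∣ C ∣ ≡ 0ℙ
    even-C = near-odd⇒even S C odd near-C
    6≤∣⊕C∣ : ∀ {X} → Relation c X → parity ∣ X ∣ ≡ 0ℙ → ¬ Near S X → 6 ≤ ∣ X ⊕ C ∣
    6≤∣⊕C∣ {X} rel-X even-X far-X =
      even-relation-size≥6 c-injective cap (X ⊕ C) (trans (parity-∣⊕∣ X C) (cong₂ _ℙ+_ even-X even-C))
        (λ X⊕C≡𝟎 → far-X (subst (Near S) (sym (⊕≡𝟎⇒≡ X C X⊕C≡𝟎)) near-C)) (relation-⊕ X C rel-X rel-C)
    6≤∣C∣ : 6 ≤ ∣ C ∣
    6≤∣C∣ = even-relation-size≥6 c-injective cap C even-C (λ C≡𝟎 → far-𝟎 (subst (Near S) C≡𝟎 near-C)) rel-C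
    42≤totalWeight : 42 ≤ totalWeight A B C
    42≤totalWeight = +-mono-≤ (+-mono-≤ (+-mono-≤ (+-mono-≤ (+-mono-≤ (+-mono-≤ 6≤∣A∣ 6≤∣B∣) 6≤∣C∣) 6≤∣A⊕B∣)
      (6≤∣⊕C∣ rel-A even-A far-A)) (6≤∣⊕C∣ rel-B even-B far-B))
      (6≤∣⊕C∣ (relation-⊕ A B rel-A rel-B) (trans (parity-∣⊕∣ A B) (cong₂ _ℙ+_ even-A even-B)) far-A⊕B)

near? : ∀ {k} (S R : Subset k) → Dec (Near S R)
near? S R = (∣ S ⊕ R ∣ ≟ 1) ⊎-dec (∣ S ⊕ R ∣ ≟ 3)

twoOrFour? : ∀ w → Dec (TwoOrFour w)
twoOrFour? w = (w ≟ 2) ⊎-dec (w ≟ 4)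

uncoveredBy? : ∀ {k} (A B S : Subset k) → Dec (UncoveredBy A B S)
uncoveredBy? A B S =
  (parity ∣ S ∣ ℙ.≟ 1ℙ) ×-dec ¬? (near? S 𝟎) ×-dec ¬? (near? S A) ×-dec ¬? (near? S B) ×-dec ¬? (near? S (A ⊕ B))

S₁ S₂ : Subset 10
S₁ = true  ∷ true  ∷ true  ∷ true  ∷ true  ∷ false ∷ false ∷ false ∷ false ∷ false ∷ []
S₂ = false ∷ false ∷ false ∷ false ∷ false ∷ true  ∷ true  ∷ true  ∷ true  ∷ true  ∷ []

-- Found by computer search.
witnesses : List (Subset 10)
witnesses =
  (true  ∷ true  ∷ true  ∷ false ∷ false ∷ true  ∷ true  ∷ false ∷ false ∷ false ∷ []) ∷
  (true  ∷ false ∷ false ∷ true  ∷ true  ∷ false ∷ false ∷ true  ∷ true  ∷ false ∷ []) ∷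
  (false ∷ true  ∷ true  ∷ false ∷ false ∷ false ∷ false ∷ true  ∷ true  ∷ true  ∷ []) ∷
  (false ∷ false ∷ false ∷ true  ∷ true  ∷ true  ∷ true  ∷ false ∷ false ∷ true  ∷ []) ∷
  (true  ∷ true  ∷ false ∷ true  ∷ false ∷ true  ∷ false ∷ true  ∷ false ∷ false ∷ []) ∷
  (false ∷ true  ∷ false ∷ false ∷ true  ∷ true  ∷ false ∷ false ∷ true  ∷ true  ∷ []) ∷
  (true  ∷ false ∷ true  ∷ false ∷ true  ∷ false ∷ true  ∷ false ∷ true  ∷ false ∷ []) ∷
  (false ∷ true  ∷ false ∷ false ∷ true  ∷ false ∷ true  ∷ true  ∷ false ∷ true  ∷ []) ∷
  (false ∷ true  ∷ true  ∷ true  ∷ true  ∷ false ∷ false ∷ false ∷ false ∷ true  ∷ []) ∷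
  (false ∷ true  ∷ false ∷ true  ∷ false ∷ true  ∷ true  ∷ false ∷ true  ∷ false ∷ []) ∷
  []

CertificateOutcome : Subset 10 → Subset 10 → Set
CertificateOutcome A B = TwoOrFour ∣ A ∣ ⊎ TwoOrFour ∣ B ∣ ⊎ TwoOrFour ∣ A ⊕ B ∣ ⊎
  (6 ≤ ∣ A ∣ × 6 ≤ ∣ B ∣ × 6 ≤ ∣ A ⊕ B ∣ × Any (UncoveredBy A B) witnesses)

certificateOutcome? : ∀ A B → Dec (CertificateOutcome A B)
certificateOutcome? A B = twoOrFour? ∣ A ∣ ⊎-dec twoOrFour? ∣ B ∣ ⊎-dec twoOrFour? ∣ A ⊕ B ∣ ⊎-dec
  (6 ≤? ∣ A ∣ ×-dec 6 ≤? ∣ B ∣ ×-dec 6 ≤? ∣ A ⊕ B ∣ ×-dec any? (uncoveredBy? A B) witnesses)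

Counterexample : Subset 4 → Set
Counterexample prefix = ∃ λ A → Near S₁ (prefix ++ A) × ∃ λ B → Near S₂ B × ¬ CertificateOutcome (prefix ++ A) B

counterexample? : ∀ prefix → Dec (Counterexample prefix)
counterexample? prefix = anySubset? λ A → near? S₁ (prefix ++ A) ×-dec anySubset? λ B →
                           near? S₂ B ×-dec ¬? (certificateOutcome? (prefix ++ A) B)

-- Evaluating one search per prefix keeps the memory used by each evaluation small.
no-counterexample : ∀ prefix → ¬ Counterexample prefix
no-counterexample p@(true  ∷ true  ∷ true  ∷ true  ∷ []) = from-no (counterexample? p)
no-counterexample p@(true  ∷ true  ∷ true  ∷ false ∷ []) = from-no (counterexample? p)
no-counterexample p@(true  ∷ true  ∷ false ∷ true  ∷ []) = from-no (counterexample? p)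
no-counterexample p@(true  ∷ true  ∷ false ∷ false ∷ []) = from-no (counterexample? p)
no-counterexample p@(true  ∷ false ∷ true  ∷ true  ∷ []) = from-no (counterexample? p)
no-counterexample p@(true  ∷ false ∷ true  ∷ false ∷ []) = from-no (counterexample? p)
no-counterexample p@(true  ∷ false ∷ false ∷ true  ∷ []) = from-no (counterexample? p)
no-counterexample p@(true  ∷ false ∷ false ∷ false ∷ []) = from-no (counterexample? p)
no-counterexample p@(false ∷ true  ∷ true  ∷ true  ∷ []) = from-no (counterexample? p)
no-counterexample p@(false ∷ true  ∷ true  ∷ false ∷ []) = from-no (counterexample? p)
no-counterexample p@(false ∷ true  ∷ false ∷ true  ∷ []) = from-no (counterexample? p)
no-counterexample p@(false ∷ true  ∷ false ∷ false ∷ []) = from-no (counterexample? p)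
no-counterexample p@(false ∷ false ∷ true  ∷ true  ∷ []) = from-no (counterexample? p)
no-counterexample p@(false ∷ false ∷ true  ∷ false ∷ []) = from-no (counterexample? p)
no-counterexample p@(false ∷ false ∷ false ∷ true  ∷ []) = from-no (counterexample? p)
no-counterexample p@(false ∷ false ∷ false ∷ false ∷ []) = from-no (counterexample? p)

certificate : ∀ A B → Near S₁ A → Near S₂ B → CertificateOutcome A B
certificate A@(a₀ ∷ a₁ ∷ a₂ ∷ a₃ ∷ A′) B near-A near-B = decidable-stable (certificateOutcome? A B)
  λ ¬outcome → no-counterexample (a₀ ∷ a₁ ∷ a₂ ∷ a₃ ∷ []) (A′ , near-A , B , near-B , ¬outcome)

corollary6p7 : (n : ℕ) (c : Fin 10 → V n) → Injective _≡_ _≡_ c → IsCap c → ¬ IsComplete c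
corollary6p7 n c c-injective cap complete
  with complete⇒odd-near-relation complete S₁ refl | complete⇒odd-near-relation complete S₂ refl
... | A , rel-A , near-A | B , rel-B , near-B with certificate A B near-A near-B
... | inj₁ small = no-relation-of-size-two-or-four c-injective cap A rel-A small
... | inj₂ (inj₁ small) = no-relation-of-size-two-or-four c-injective cap B rel-B small
... | inj₂ (inj₂ (inj₁ small)) = no-relation-of-size-two-or-four c-injective cap (A ⊕ B) (relation-⊕ A B rel-A rel-B) small
... | inj₂ (inj₂ (inj₂ (6≤∣A∣ , 6≤∣B∣ , 6≤∣A⊕B∣ , uncovered))) with satisfied uncovered
...   | S₃ , S₃-uncovered =
  plane-covers-odd-subsets c-injective cap complete ≤-refl A B S₃ rel-A rel-B
    (near-odd⇒even S₁ A refl near-A) (near-odd⇒even S₂ B refl near-B) 6≤∣A∣ 6≤∣B∣ 6≤∣A⊕B∣ S₃-uncovered
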